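{- For every basic sequence $\alpha$ there exists a basic sequence $\overline{\alpha}$ such that the concatenation $\alpha\overline{\alpha}$ is a quiddity sequence.
   Context: A basic sequence is a finite sequence of integers $(1,A_1,\dots,A_n)$ with $n\ge 1$ and $A_1,\dots,A_n\ge 2$. Quiddity sequences (equivalently $\eta$-sequences) are finite sequences of positive integers of length $\ge 3$ defined recursively: (1) $(1,1,1)$ is a quiddity sequence; (2) if $(c_0,c_1,\dots,c_{n-1})$ is a quiddity sequence then so is $(c_1,\dots,c_{n-1},c_0)$; (3) if $(c_0,c_1,c_2,\dots,c_{n-1})$ is a quiddity sequence then so is $(c_0+1,1,c_1+1,c_2,\dots,c_{n-1})$; only sequences obtained this way are quiddity sequences. (Equivalently, $(a_0,\dots,a_{n-1})$ is a quiddity sequence iff there is a triangulation of a convex $n$-gon with vertices $0,\dots,n-1$ in cyclic order by non-crossing diagonals such that $a_i$ is the number of triangles incident to vertex $i$.) -}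

module Defs where

open import Data.Nat using (ℕ; suc; _≥_)
open import Data.List using (List; []; _∷_; _++_; [_])
open import Data.List.Relation.Unary.All using (All)

data Quiddity : List ℕ → Set where
  base   : Quiddity (1 ∷ 1 ∷ 1 ∷ [])
  rotate : ∀ c₀ cs → Quiddity (c₀ ∷ cs) → Quiddity (cs ++ [ c₀ ])
  insert : ∀ c₀ c₁ cs → Quiddity (c₀ ∷ c₁ ∷ cs)
         → Quiddity (suc c₀ ∷ 1 ∷ suc c₁ ∷ cs)

data Basic : List ℕ → Set where
  basic : ∀ A As → All (λ a → a ≥ 2) (A ∷ As) → Basic (1 ∷ A ∷ As)

module Submission where

-- Quiddity sequences are closed under rotating any block to the
-- end, so the insertion rule can be applied next to the opening 1 of α:
--   * inserting between that 1 and A₁ raises A₁ by one and appends a 2 to ᾱ;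
--   * inserting between the last entry B of ᾱ and the opening 1 raises B by
--     one and places a new entry 2 in front of α's tail.
-- Call a "completion" of α a tail (1, B₁, …, Bₘ), m ≥ 1, all Bᵢ ≥ 2, such
-- that α followed by it is a quiddity sequence.  The square (1,2,1,2)
-- completes (1,2); the second move turns a completion of (1, A₂, …, Aₙ) into
-- one of (1, 2, A₂, …, Aₙ); the first move then raises that 2 to A₁.  By
-- induction on n every basic sequence has a completion, and a completion is
-- exactly a basic sequence ᾱ with the required property.

open import Defs
open import Data.Nat using (ℕ; zero; suc; _+_; _≥_; s≤s; z≤n)
open import Data.Nat.Properties using (m≤n⇒m≤1+n)
open import Data.List using (List; []; _∷_; _++_; [_]; _∷ʳ_)
open import Data.List.Properties using (++-assoc; ++-identityʳ)
open import Data.List.Relation.Unary.All using (All; []; _∷_)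
open import Data.List.Relation.Unary.All.Properties using (∷ʳ⁺; ∷ʳ⁻)
open import Data.Product using (Σ; _×_; _,_)
open import Relation.Binary.PropositionalEquality using (sym; subst)

rotateBlock : ∀ xs ys → Quiddity (xs ++ ys) → Quiddity (ys ++ xs)
rotateBlock []       ys q = subst Quiddity (sym (++-identityʳ ys)) q
rotateBlock (x ∷ xs) ys q = subst Quiddity (++-assoc ys [ x ] xs) rotated
  where
  shifted : Quiddity (xs ++ ys ∷ʳ x)
  shifted = subst Quiddity (++-assoc xs ys [ x ]) (rotate x (xs ++ ys) q)

  rotated : Quiddity ((ys ∷ʳ x) ++ xs)
  rotated = rotateBlock xs (ys ∷ʳ x) shifted

raiseAfterOne : ∀ a w → Quiddity (1 ∷ a ∷ w) → Quiddity (1 ∷ suc a ∷ w ∷ʳ 2)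
raiseAfterOne a w q = rotate 2 (1 ∷ suc a ∷ w) (insert 1 a w q)

twoAfterOne : ∀ w b → Quiddity (1 ∷ w ∷ʳ b) → Quiddity (1 ∷ 2 ∷ w ∷ʳ suc b)
twoAfterOne w b q =
  rotate (suc b) (1 ∷ 2 ∷ w) (insert b 1 w (rotateBlock (1 ∷ w) [ b ] q))

Large : ℕ → Set
Large a = a ≥ 2

two-large : Large 2
two-large = s≤s (s≤s z≤n)

raiseLast : ∀ xs b → All Large (xs ∷ʳ b) → All Large (xs ∷ʳ suc b)
raiseLast xs b large with ∷ʳ⁻ large
... | large-xs , large-b = ∷ʳ⁺ large-xs (m≤n⇒m≤1+n large-b)

-- A completion of α: a tail (1, B₁, …, Bₘ) with m ≥ 1 and every Bᵢ ≥ 2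
-- (the Bᵢ are split as init ∷ʳ last, the form both moves act on) such that
-- α followed by it is a quiddity sequence.
record Completion (α : List ℕ) : Set where
  constructor completion
  field
    init     : List ℕ
    last     : ℕ
    large    : All Large (init ∷ʳ last)
    quiddity : Quiddity (α ++ 1 ∷ init ∷ʳ last)

completionBasic : ∀ init b → All Large (init ∷ʳ b) → Basic (1 ∷ init ∷ʳ b)
completionBasic []       b large = basic b [] large
completionBasic (x ∷ xs) b large = basic x (xs ∷ʳ b) large

completeTwo : Completion (1 ∷ 2 ∷ [])
completeTwo = completion [] 2 (two-large ∷ []) square
  where
  square : Quiddity (1 ∷ 2 ∷ 1 ∷ 2 ∷ [])
  square = raiseAfterOne 1 [ 1 ] base

raiseFirst : ∀ a as → Completion (1 ∷ a ∷ as) → Completion (1 ∷ suc a ∷ as)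
raiseFirst a as (completion init b large q) =
  completion (init ∷ʳ b) 2 (∷ʳ⁺ large two-large)
    (subst (λ w → Quiddity (1 ∷ suc a ∷ w)) (++-assoc as (1 ∷ init ∷ʳ b) [ 2 ])
      (raiseAfterOne a (as ++ 1 ∷ init ∷ʳ b) q))

prependTwo : ∀ as → Completion (1 ∷ as) → Completion (1 ∷ 2 ∷ as)
prependTwo as (completion init b large q) =
  completion init (suc b) (raiseLast init b large)
    (subst (λ w → Quiddity (1 ∷ 2 ∷ w)) (++-assoc as (1 ∷ init) [ suc b ])
      (twoAfterOne (as ++ 1 ∷ init) b
        (subst (λ w → Quiddity (1 ∷ w)) (sym (++-assoc as (1 ∷ init) [ b ])) q)))

raiseFirstBy : ∀ k as → Completion (1 ∷ 2 ∷ as) → Completion (1 ∷ 2 + k ∷ as)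
raiseFirstBy zero    as c = c
raiseFirstBy (suc k) as c = raiseFirst (2 + k) as (raiseFirstBy k as c)

complete : ∀ a as → All Large (a ∷ as) → Completion (1 ∷ a ∷ as)
complete (suc (suc k)) []       (s≤s (s≤s _) ∷ [])       = raiseFirstBy k [] completeTwo
complete (suc (suc k)) (a ∷ as) (s≤s (s≤s _) ∷ large-as) =
  raiseFirstBy k (a ∷ as) (prependTwo (a ∷ as) (complete a as large-as))

proposition2 : (α : List ℕ) → Basic α → Σ (List ℕ) (λ β → Basic β × Quiddity (α ++ β))
proposition2 .(1 ∷ A ∷ As) (basic A As large) with complete A As large
... | completion init b large-tail q =
  1 ∷ init ∷ʳ b , completionBasic init b large-tail , q
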